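{- For every graph $G$ and every $r\in\mathbb{N}\cup\{\infty\}$ with $r\ge1$, $$\operatorname{scol}_r(G)\le\operatorname{sw}_r(G)+1\le\operatorname{wcol}_r(G)\quad\text{and}\quad \operatorname{scol}_r(G)\le\operatorname{sw}_r(G)+1\le\operatorname{scol}_{2r-1}(G)$$ (with $2\cdot\infty-1=\infty$).
   Context: Graphs are finite, simple, undirected. For a total order $\le$ on $V(G)$ and $r\in\mathbb{N}\cup\{\infty\}$: $u$ is strongly $r$-reachable from $v$ if $u\le v$ and there is a path of length at most $r$ from $v$ to $u$ all of whose inner vertices are larger than $v$; $u$ is weakly $r$-reachable from $v$ if $u\le v$ and there is such a path all of whose inner vertices are larger than $u$ (in particular $v$ is reachable from itself). $\operatorname{scol}_r(G)$ (resp. $\operatorname{wcol}_r(G)$) is the least $k$ such that for some total order every vertex has at most $k$ strongly (resp. weakly) $r$-reachable vertices. For $S\subseteq V(G)$ and $v\in V(G)\setminus S$, $\operatorname{sep}_r(v/S)$ is the set of vertices of $S$ reachable from $v$ by a path of length at most $r$ whose inner vertices are not in $S$; the separation-width $\operatorname{sw}_r(G)$ is the least $k$ such that there is a total order $\le$ on $V(G)$ with $|\operatorname{sep}_r(v/S)|\le k$ for every $\le$-downward closed $S\subseteq V(G)$ and every $v\in V(G)\setminus S$. -}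

module Defs where

open import Data.Nat using (ℕ; zero; suc; _+_; _∸_; _≤_; _<_)
open import Data.Fin using (Fin; toℕ)
open import Data.Fin.Subset using (Subset; _∈_; _∉_)
open import Data.List using (List; []; _∷_; _++_; length)
open import Data.List.Relation.Unary.All using (All)
open import Data.List.Relation.Unary.Linked using (Linked)
open import Data.List.Relation.Unary.Unique.Propositional using (Unique)
open import Data.Product using (Σ; _×_; ∃)
open import Data.Sum using (_⊎_)
open import Data.Unit using (⊤)
open import Relation.Nullary using (¬_)
open import Relation.Binary using (Decidable)
open import Relation.Binary.PropositionalEquality using (_≡_)
open import Function.Definitions using (Injective)

data ℕ∞ : Set where
  fin : ℕ → ℕ∞
  ∞   : ℕ∞

_≤∞_ : ℕ → ℕ∞ → Set
ℓ ≤∞ fin r = ℓ ≤ r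
ℓ ≤∞ ∞     = ⊤

1≤∞_ : ℕ∞ → Set
1≤∞ fin r = 1 ≤ r
1≤∞ ∞     = ⊤

twoR-1 : ℕ∞ → ℕ∞
twoR-1 (fin r) = fin ((r + r) ∸ 1)
twoR-1 ∞ = ∞

record Graph (n : ℕ) : Set₁ where
  field
    Adj     : Fin n → Fin n → Set
    adj?    : Decidable Adj
    sym     : ∀ {u v} → Adj u v → Adj v u
    irrefl  : ∀ {u} → ¬ Adj u u
open Graph public

record Order (n : ℕ) : Set where
  field
    rank    : Fin n → Fin n
    rank-inj : Injective _≡_ _≡_ rank
open Order public

_≼[_]_ : ∀ {n} → Fin n → Order n → Fin n → Set
u ≼[ O ] v = toℕ (rank O u) ≤ toℕ (rank O v)

_≺[_]_ : ∀ {n} → Fin n → Order n → Fin n → Set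
u ≺[ O ] v = toℕ (rank O u) < toℕ (rank O v)

IsPath : ∀ {n} → Graph n → Fin n → Fin n → List (Fin n) → ℕ → Set
IsPath G v u is ℓ =
    (v ≡ u × is ≡ [] × ℓ ≡ 0)
  ⊎ (Linked (Adj G) (v ∷ is ++ u ∷ []) × Unique (v ∷ is ++ u ∷ []) × ℓ ≡ suc (length is))

PathVia : ∀ {n} → Graph n → ℕ∞ → (Fin n → Set) → Fin n → Fin n → Set
PathVia {n} G r P v u =
  Σ (List (Fin n)) λ is → Σ ℕ λ ℓ → IsPath G v u is ℓ × ℓ ≤∞ r × All P is

SReach : ∀ {n} → Graph n → Order n → ℕ∞ → Fin n → Fin n → Set
SReach G O r v u = u ≼[ O ] v × PathVia G r (λ w → v ≺[ O ] w) v u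

WReach : ∀ {n} → Graph n → Order n → ℕ∞ → Fin n → Fin n → Set
WReach G O r v u = u ≼[ O ] v × PathVia G r (λ w → u ≺[ O ] w) v u

AtMost : ∀ {n} → ℕ → (Fin n → Set) → Set
AtMost {n} k P = ∀ (xs : List (Fin n)) → Unique xs → All P xs → length xs ≤ k

Sep : ∀ {n} → Graph n → ℕ∞ → Subset n → Fin n → Fin n → Set
Sep G r S v u = u ∈ S × PathVia G r (λ w → w ∉ S) v u

DownClosed : ∀ {n} → Order n → Subset n → Set
DownClosed {n} O S = ∀ (u v : Fin n) → v ∈ S → u ≼[ O ] v → u ∈ S

SColBound : ∀ {n} → Graph n → ℕ∞ → ℕ → Set
SColBound {n} G r k = Σ (Order n) λ O → ∀ v → AtMost k (SReach G O r v)

WColBound : ∀ {n} → Graph n → ℕ∞ → ℕ → Set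
WColBound {n} G r k = Σ (Order n) λ O → ∀ v → AtMost k (WReach G O r v)

SWBound : ∀ {n} → Graph n → ℕ∞ → ℕ → Set
SWBound {n} G r k = Σ (Order n) λ O →
  ∀ (S : Subset n) → DownClosed O S → ∀ v → v ∉ S → AtMost k (Sep G r S v)

IsLeast : (ℕ → Set) → ℕ → Set
IsLeast B m = B m × (∀ k → B k → m ≤ k)

IsSCol : ∀ {n} → Graph n → ℕ∞ → ℕ → Set
IsSCol G r = IsLeast (SColBound G r)

IsWCol : ∀ {n} → Graph n → ℕ∞ → ℕ → Set
IsWCol G r = IsLeast (WColBound G r)

IsSW : ∀ {n} → Graph n → ℕ∞ → ℕ → Set
IsSW G r = IsLeast (SWBound G r)

-- For the order witnessing sw_r and a vertex v, let S be the set of vertices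
-- below v: the strongly r-reachable vertices of v other than v form
-- sep_r(v/S), so scol_r ≤ sw_r + 1. Conversely fix an order, a down-closed
-- S and v ∉ S. Every vertex of sep_r(v/S) is weakly r-reachable from v, which
-- together with v itself gives sw_r + 1 ≤ wcol_r. For the strong bound let x
-- be the least vertex reachable from v by a walk of length at most r - 1 in
-- G - S. For u ∈ sep_r(v/S) the walk x → v → u has length at most 2r - 1 and
-- all its vertices except u lie in that ball, hence above x; shortening it to
-- a path shows that u is strongly (2r-1)-reachable from x, and together with
-- x this gives sw_r + 1 ≤ scol_{2r-1}. For r = ∞ the radius is first replaced
-- by the longest of the finitely many paths witnessing membership in sep_r.
module Submission where

open import Defs
open import Data.Nat using (ℕ; suc; _≤_)
open import Data.Product using (_×_)

open import Level using (Level) renaming (_⊔_ to _⊔ℓ_)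
open import Function using (_∘_; id)
open import Data.Empty using (⊥-elim)
open import Data.Unit using (tt)
open import Data.Nat using (zero; _+_; _∸_; _⊔_; pred; _<_; _<?_; _≤′_; ≤′-refl; ≤′-step; z≤n; s≤s)
open import Data.Nat.Properties
  using (≤-refl; ≤-reflexive; ≤-trans; n≤1+n; m≤n⇒m≤1+n; <⇒≤; ≮⇒≥; ≤∧≢⇒<; <-irrefl; <-asym;
         ≤-<-trans; m≤m⊔n; m≤n⊔m; ⊔-lub; +-comm; +-suc; +-mono-≤; m≤m+n; pred-mono-≤;
         pred[m∸n]≡m∸[1+n]; suc[m]≤n⇒m≤pred[n]; ≤⇒≤′; module ≤-Reasoning)
open import Data.Nat.Induction using (<-wellFounded)
open import Induction.WellFounded using (Acc; acc)
open import Data.Fin using (Fin; toℕ) renaming (zero to fzero)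
open import Data.Fin.Properties using (any?; toℕ-injective) renaming (_≟_ to _≟ᶠ_)
open import Data.Fin.Subset using (Subset; _∈_; _∉_)
open import Data.Fin.Subset.Properties using () renaming (_∈?_ to _∈ˢ?_)
open import Data.Vec using (tabulate)
open import Data.Vec.Properties using (lookup∘tabulate; lookup⇒[]=; []=⇒lookup)
open import Data.List using (List; []; _∷_; _++_; _∷ʳ_; length; filter)
open import Data.List.Properties using (length-++; filter-all)
open import Data.List.Relation.Unary.All as All using (All; []; _∷_)
open import Data.List.Relation.Unary.All.Properties
  using (¬Any⇒All¬; ++⁺; ∷ʳ⁺; ∷ʳ⁻; anti-mono; all-filter; filter⁺)
open import Data.List.Relation.Unary.Any using (here; there)
open import Data.List.Relation.Unary.Linked using (Linked; [-]; _∷_)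
open import Data.List.Relation.Unary.AllPairs using ([]; _∷_)
open import Data.List.Relation.Unary.Unique.Propositional using (Unique)
import Data.List.Relation.Unary.Unique.Propositional.Properties as Unique
open import Data.List.Relation.Binary.Subset.Propositional using () renaming (_⊆_ to _⊆ˡ_)
open import Data.List.Membership.Propositional using () renaming (_∈_ to _∈ˡ_)
import Data.List.Membership.DecPropositional as DecMembership
open import Data.Product using (Σ-syntax; ∃-syntax; _,_; proj₁; proj₂; map₂)
open import Data.Sum using (_⊎_; inj₁; inj₂)
open import Relation.Nullary using (Dec; yes; no; does)
open import Relation.Nullary.Decidable using (_×-dec_; _⊎-dec_; ¬?; dec-true)
open import Relation.Unary using (Pred; Decidable)
open import Relation.Binary using (Rel; DecidableEquality)
open import Relation.Binary.PropositionalEquality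
  using (_≡_; _≢_; refl; trans; cong; ≢-sym) renaming (sym to ≡-sym)

private
  variable
    a p : Level
    A : Set a
    n : ℕ

z≤∞ : ∀ r → 0 ≤∞ r
z≤∞ (fin _) = z≤n
z≤∞ ∞       = tt

≤-≤∞-trans : ∀ {k m} r → k ≤ m → m ≤∞ r → k ≤∞ r
≤-≤∞-trans (fin _) = ≤-trans
≤-≤∞-trans ∞       _ _ = tt

⊔-lub-≤∞ : ∀ {k m} r → k ≤∞ r → m ≤∞ r → (k ⊔ m) ≤∞ r
⊔-lub-≤∞ (fin _) = ⊔-lub
⊔-lub-≤∞ ∞       _ _ = tt

pred+≤∞twoR-1 : ∀ {k} r → k ≤∞ r → (pred k + k) ≤∞ twoR-1 r
pred+≤∞twoR-1 ∞ _ = tt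
pred+≤∞twoR-1 {k} (fin r) k≤r = begin
  pred k + k   ≡⟨ pred[m]+m≡pred[m+m] k ⟩
  pred (k + k) ≤⟨ pred-mono-≤ (+-mono-≤ k≤r k≤r) ⟩
  pred (r + r) ≡⟨ pred[m∸n]≡m∸[1+n] (r + r) 0 ⟩
  r + r ∸ 1    ∎
  where
  open ≤-Reasoning
  pred[m]+m≡pred[m+m] : ∀ m → pred m + m ≡ pred (m + m)
  pred[m]+m≡pred[m+m] zero    = refl
  pred[m]+m≡pred[m+m] (suc _) = refl

length-∷ʳ : ∀ (xs : List A) x → length (xs ∷ʳ x) ≡ suc (length xs)
length-∷ʳ xs _ = trans (length-++ xs) (+-comm (length xs) 1)

Unique-∷ʳ⁻ : ∀ (xs : List A) {z} → Unique (xs ∷ʳ z) → All (_≢ z) xs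
Unique-∷ʳ⁻ []       _          = []
Unique-∷ʳ⁻ (_ ∷ xs) (x≢ ∷ uniq) = proj₂ (∷ʳ⁻ x≢) ∷ Unique-∷ʳ⁻ xs uniq

module _ (_≟_ : DecidableEquality A) where

  length≤suc-length-filter≢ : ∀ x {ys : List A} → Unique ys →
                              length ys ≤ suc (length (filter (¬? ∘ (_≟ x)) ys))
  length≤suc-length-filter≢ x {[]}     _ = z≤n
  length≤suc-length-filter≢ x {y ∷ ys} (y≢ys ∷ uniq) with y ≟ x
  ... | yes refl rewrite filter-all (¬? ∘ (_≟ x)) (All.map ≢-sym y≢ys) = ≤-refl
  ... | no _     = s≤s (length≤suc-length-filter≢ x uniq)

module _ {k : ℕ} {P : Fin n → Set} where

  AtMost-positive : ∀ {x} → AtMost k P → P x → 0 < k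
  AtMost-positive {x} P≤k Px = P≤k (x ∷ []) ([] ∷ []) (Px ∷ [])

  AtMost-insert : ∀ {Q x} → AtMost k Q → (∀ {y} → P y → y ≢ x → Q y) → AtMost (suc k) P
  AtMost-insert {x = x} Q≤k P⊆Q∪x ys uniq Pys = ≤-trans (length≤suc-length-filter≢ _≟ᶠ_ x uniq)
    (s≤s (Q≤k (filter x≢? ys) (Unique.filter⁺ x≢? uniq)
      (All.zipWith (λ (Py , y≢x) → P⊆Q∪x Py y≢x) (filter⁺ x≢? Pys , all-filter x≢? ys))))
    where x≢? = ¬? ∘ (_≟ᶠ x)

  AtMost-delete : ∀ {Q x} → AtMost k P → P x → (∀ {y} → Q y → P y) → (∀ {y} → Q y → y ≢ x) →
                  AtMost (pred k) Q
  AtMost-delete P≤k Px Q⊆P Q∌x ys uniq Qys =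
    suc[m]≤n⇒m≤pred[n] (P≤k (_ ∷ ys) (All.map (≢-sym ∘ Q∌x) Qys ∷ uniq) (Px ∷ All.map Q⊆P Qys))

IsLeast⇒suc≤ : ∀ {B : ℕ → Set} {t k} → IsLeast B t → 0 < k → B (pred k) → suc t ≤ k
IsLeast⇒suc≤ {k = suc _} (_ , least) _ B[k-1] = s≤s (least _ B[k-1])

module _ {P : Pred (Fin n) p} (P? : Decidable P) where

  fromDec : Subset n
  fromDec = tabulate (does ∘ P?)

  ∈-fromDec⁺ : ∀ {x} → P x → x ∈ fromDec
  ∈-fromDec⁺ {x} Px = lookup⇒[]= x fromDec (trans (lookup∘tabulate _ x) (dec-true (P? x) Px))

  ∈-fromDec⁻ : ∀ {x} → x ∈ fromDec → P x
  ∈-fromDec⁻ {x} x∈ with P? x | trans (≡-sym ([]=⇒lookup x∈)) (lookup∘tabulate (does ∘ P?) x)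
  ... | yes Px | _  = Px
  ... | no  _  | ()

  argmin : (f : Fin n → ℕ) → ∀ {x} → P x → Σ[ m ∈ Fin n ] P m × (∀ {y} → P y → f m ≤ f y)
  argmin f {x} = search (<-wellFounded (f x))
    where
    search : ∀ {x} → Acc _<_ (f x) → P x → Σ[ m ∈ Fin n ] P m × (∀ {y} → P y → f m ≤ f y)
    search {x} (acc smaller) Px with any? (λ y → P? y ×-dec f y <? f x)
    ... | yes (_ , Py , fy<fx) = search (smaller fy<fx) Py
    ... | no ∄smaller          = x , Px , λ Py → ≮⇒≥ (λ fy<fx → ∄smaller (_ , Py , fy<fx))

module Walks {a ℓ} {A : Set a} (R : Rel A ℓ) where

  Ends : A → List A → A → Set a
  Ends x []       y = x ≡ y
  Ends _ (z ∷ zs) y = Ends z zs y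

  ends-∷ʳ : ∀ x zs y → Ends x (zs ∷ʳ y) y
  ends-∷ʳ _ []       _ = refl
  ends-∷ʳ _ (z ∷ zs) y = ends-∷ʳ z zs y

  ends-++ : ∀ {x y z} vs {ws} → Ends x vs y → Ends y ws z → Ends x (vs ++ ws) z
  ends-++ []       refl e′ = e′
  ends-++ (_ ∷ vs) e    e′ = ends-++ vs e e′

  ends⇒∷ʳ : ∀ {x y} zs → Ends x zs y → zs ≡ [] × x ≡ y ⊎ ∃[ is ] zs ≡ is ∷ʳ y
  ends⇒∷ʳ []       x≡y = inj₁ (refl , x≡y)
  ends⇒∷ʳ (z ∷ zs) e with ends⇒∷ʳ zs e
  ... | inj₁ (refl , refl) = inj₂ ([] , refl)
  ... | inj₂ (is , eq)     = inj₂ (z ∷ is , cong (z ∷_) eq)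

  linked-++ : ∀ {x y ws} vs → Linked R (x ∷ vs) → Ends x vs y → Linked R (y ∷ ws) →
              Linked R (x ∷ vs ++ ws)
  linked-++ []       _       refl l′ = l′
  linked-++ (_ ∷ vs) (r ∷ l) e    l′ = r ∷ linked-++ vs l e l′

  -- A walk from x visits x ∷ steps; its length is length steps.
  record Walk (x y : A) : Set (a ⊔ℓ ℓ) where
    constructor walk
    field
      steps  : List A
      linked : Linked R (x ∷ steps)
      ends   : Ends x steps y
  open Walk public

  _▻_ : ∀ {x y z} → Walk x y → Walk y z → Walk x z
  walk vs l e ▻ walk ws l′ e′ = walk (vs ++ ws) (linked-++ vs l e l′) (ends-++ vs e e′)

  record PathWithin (x y : A) (k : ℕ) (U : List A) : Set (a ⊔ℓ ℓ) where
    field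
      path     : Walk x y
      distinct : Unique (x ∷ steps path)
      short    : length (steps path) ≤ k
      within   : x ∷ steps path ⊆ˡ U
  open PathWithin public

  PathWithin-weaken : ∀ {x y k k′ U U′} → k ≤ k′ → U ⊆ˡ U′ →
                      PathWithin x y k U → PathWithin x y k′ U′
  PathWithin-weaken k≤k′ U⊆U′ q = record
    { path     = path q
    ; distinct = distinct q
    ; short    = ≤-trans (short q) k≤k′
    ; within   = U⊆U′ ∘ within q
    }

  suffixFrom : ∀ {c x y} (p : Walk c y) → Unique (c ∷ steps p) → x ∈ˡ c ∷ steps p →
               PathWithin x y (length (steps p)) (c ∷ steps p)
  suffixFrom p uniq (here refl) = record { path = p ; distinct = uniq ; short = ≤-refl ; within = id }
  suffixFrom (walk (_ ∷ ds) (_ ∷ l) e) (_ ∷ uniq) (there x∈) =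
    PathWithin-weaken (n≤1+n _) there (suffixFrom (walk ds l e) uniq x∈)

  module _ (_≟_ : DecidableEquality A) where
    open DecMembership _≟_ using (_∈?_)

    shortcut : ∀ {x y} (p : Walk x y) → PathWithin x y (length (steps p)) (x ∷ steps p)
    shortcut p@(walk [] _ _) = record { path = p ; distinct = [] ∷ [] ; short = z≤n ; within = id }
    shortcut {x} (walk (c ∷ cs) (r ∷ l) e) with shortcut (walk cs l e)
    ... | q with x ∈? c ∷ steps (path q)
    ...   | yes x∈ = PathWithin-weaken (m≤n⇒m≤1+n (short q)) (there ∘ within q)
                       (suffixFrom (path q) (distinct q) x∈)
    ...   | no x∉ = record
      { path     = walk (c ∷ steps (path q)) (r ∷ linked (path q)) (ends (path q))
      ; distinct = ¬Any⇒All¬ _ x∉ ∷ distinct q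
      ; short    = s≤s (short q)
      ; within   = λ { (here refl) → here refl ; (there y∈) → there (within q y∈) }
      }

module _ (G : Graph n) where
  open Walks (Adj G)

  PathVia-refl : ∀ r {P : Fin n → Set} {x} → PathVia G r P x x
  PathVia-refl r = [] , 0 , inj₁ (refl , refl , refl) , z≤∞ r , []

  PathVia-map : ∀ {r} {P Q : Fin n → Set} {x y} → (∀ {w} → P w → Q w) →
                PathVia G r P x y → PathVia G r Q x y
  PathVia-map P⊆Q (is , ℓ , isPath , ℓ≤r , Pis) = is , ℓ , isPath , ℓ≤r , All.map P⊆Q Pis

  PathVia-mono : ∀ {m} r {P : Fin n → Set} {x y} → m ≤∞ r →
                 PathVia G (fin m) P x y → PathVia G r P x y
  PathVia-mono r m≤r (is , ℓ , isPath , ℓ≤m , Pis) = is , ℓ , isPath , ≤-≤∞-trans r ℓ≤m m≤r , Pis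

  Walk⇒PathVia : ∀ {P Q : Fin n → Set} {x u} (p : Walk x u) → Unique (x ∷ steps p) → x ≢ u →
                 All Q (x ∷ steps p) → (∀ {y} → Q y → y ≢ x → y ≢ u → P y) →
                 PathVia G (fin (length (steps p))) P x u
  Walk⇒PathVia (walk zs l e) uniq x≢u Qzs Q⇒P with ends⇒∷ʳ zs e
  ... | inj₁ (_ , x≡u) = ⊥-elim (x≢u x≡u)
  Walk⇒PathVia {u = u} (walk .(is ∷ʳ u) l e) uniq@(x≢is∷ʳu ∷ is∷ʳu-unique) _ (_ ∷ Qis∷ʳu) Q⇒P
    | inj₂ (is , refl) =
    is , _ , inj₂ (l , uniq , length-∷ʳ is u) , ≤-refl ,
    All.map (λ (Qy , x≢y , y≢u) → Q⇒P Qy (≢-sym x≢y) y≢u)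
      (All.zip (proj₁ (∷ʳ⁻ Qis∷ʳu) , All.zip (proj₁ (∷ʳ⁻ x≢is∷ʳu) , Unique-∷ʳ⁻ is is∷ʳu-unique)))

∈∧∉⇒≢ : ∀ {S : Subset n} {u w} → u ∈ S → w ∉ S → u ≢ w
∈∧∉⇒≢ u∈S w∉S refl = w∉S u∈S

module _ (O : Order n) where

  _≺?_ : ∀ x y → Dec (x ≺[ O ] y)
  x ≺? y = toℕ (rank O x) <? toℕ (rank O y)

  ≼∧≢⇒≺ : ∀ {x y} → x ≼[ O ] y → x ≢ y → x ≺[ O ] y
  ≼∧≢⇒≺ x≼y x≢y = ≤∧≢⇒< x≼y (x≢y ∘ rank-inj O ∘ toℕ-injective)

  DownClosed⇒∈≺∉ : ∀ {S} → DownClosed O S → ∀ {u w} → u ∈ S → w ∉ S → u ≺[ O ] w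
  DownClosed⇒∈≺∉ dc {u} {w} u∈S w∉S with u ≺? w
  ... | yes u≺w = u≺w
  ... | no  u⊀w = ⊥-elim (w∉S (dc w u u∈S (≮⇒≥ u⊀w)))

  below : Fin n → Subset n
  below v = fromDec (_≺? v)

  ∈-below⁺ : ∀ {u v} → u ≺[ O ] v → u ∈ below v
  ∈-below⁺ {v = v} = ∈-fromDec⁺ (_≺? v)

  ∈-below⁻ : ∀ {u v} → u ∈ below v → u ≺[ O ] v
  ∈-below⁻ {v = v} = ∈-fromDec⁻ (_≺? v)

  below-downClosed : ∀ v → DownClosed O (below v)
  below-downClosed v u w w∈ u≼w = ∈-below⁺ (≤-<-trans u≼w (∈-below⁻ w∈))

  ∉-below : ∀ v → v ∉ below v
  ∉-below v = <-irrefl refl ∘ ∈-below⁻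

-- scol_r ≤ sw_r + 1 ≤ wcol_r

module _ (G : Graph n) (r : ℕ∞) where

  SReach-refl : ∀ O v → SReach G O r v v
  SReach-refl _ _ = ≤-refl , PathVia-refl G r

  WReach-refl : ∀ O v → WReach G O r v v
  WReach-refl _ _ = ≤-refl , PathVia-refl G r

  SColBound-positive : ∀ {s} → Fin n → SColBound G r s → 0 < s
  SColBound-positive v (O , sreach≤s) = AtMost-positive (sreach≤s v) (SReach-refl O v)

  WColBound-positive : ∀ {w} → Fin n → WColBound G r w → 0 < w
  WColBound-positive v (O , wreach≤w) = AtMost-positive (wreach≤w v) (WReach-refl O v)

  SReach⇒Sep-below : ∀ {O v u} → SReach G O r v u → u ≢ v → Sep G r (below O v) v u
  SReach⇒Sep-below {O} (u≼v , path) u≢v =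
    ∈-below⁺ O (≼∧≢⇒≺ O u≼v u≢v) , PathVia-map G (λ v≺w w∈ → <-asym v≺w (∈-below⁻ O w∈)) path

  SWBound⇒SColBound : ∀ {t} → SWBound G r t → SColBound G r (suc t)
  SWBound⇒SColBound (O , sep≤t) = O , λ v →
    AtMost-insert (sep≤t (below O v) (below-downClosed O v) v (∉-below O v))
      (SReach⇒Sep-below {O} {v})

  Sep⇒WReach : ∀ {O S v u} → DownClosed O S → v ∉ S → Sep G r S v u → WReach G O r v u
  Sep⇒WReach {O} dc v∉S (u∈S , path) =
    <⇒≤ (DownClosed⇒∈≺∉ O dc u∈S v∉S) , PathVia-map G (DownClosed⇒∈≺∉ O dc u∈S) path

  WColBound⇒SWBound : ∀ {w} → WColBound G r w → SWBound G r (pred w)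
  WColBound⇒SWBound (O , wreach≤w) = O , λ S dc v v∉S →
    AtMost-delete (wreach≤w v) (WReach-refl O v) (Sep⇒WReach {O} dc v∉S)
      (λ (u∈S , _) → ∈∧∉⇒≢ u∈S v∉S)

-- sw_r + 1 ≤ scol_{2r-1}

module _ (G : Graph n) (S : Subset n) (v : Fin n) where
  open Walks (Adj G)

  -- Ball k y : y is reached from v by a walk of length at most k whose
  -- vertices after v all lie outside S.
  Ball : ℕ → Fin n → Set
  Ball zero    y = y ≡ v
  Ball (suc k) y = Ball k y ⊎ ∃[ z ] Ball k z × Adj G z y × y ∉ S

  ball? : ∀ k → Decidable (Ball k)
  ball? zero    y = y ≟ᶠ v
  ball? (suc k) y = ball? k y ⊎-dec any? (λ z → ball? k z ×-dec adj? G z y ×-dec ¬? (y ∈ˢ? S))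

  ball-mono : ∀ {k m y} → k ≤ m → Ball k y → Ball m y
  ball-mono = go ∘ ≤⇒≤′
    where
    go : ∀ {k m y} → k ≤′ m → Ball k y → Ball m y
    go ≤′-refl       b = b
    go (≤′-step k≤m) b = inj₁ (go k≤m b)

  ball-∉ : v ∉ S → ∀ {k y} → Ball k y → y ∉ S
  ball-∉ v∉S {zero}  refl                    = v∉S
  ball-∉ v∉S {suc k} (inj₁ b)                = ball-∉ v∉S b
  ball-∉ v∉S {suc k} (inj₂ (_ , _ , _ , y∉S)) = y∉S

  ball-walk : ∀ {k y} → Ball k y →
              Σ[ p ∈ Walk y v ] length (steps p) ≤ k × All (Ball k) (y ∷ steps p)
  ball-walk {zero} refl = walk [] [-] refl , z≤n , refl ∷ []
  ball-walk {suc k} (inj₁ b) with ball-walk b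
  ... | p , short , balls = p , m≤n⇒m≤1+n short , All.map inj₁ balls
  ball-walk {suc k} b@(inj₂ (z , bz , zy , _)) with ball-walk bz
  ... | walk vs l e , short , balls =
    walk (z ∷ vs) (Graph.sym G zy ∷ l) e , s≤s short , b ∷ All.map inj₁ balls

  ball-along : ∀ {k m z} is {ws} → Ball k z → Linked (Adj G) (z ∷ is ++ ws) → All (_∉ S) is →
               k + length is ≤ m → All (Ball m) (z ∷ is)
  ball-along {k} []       bz _        _            k≤m  = ball-mono (≤-trans (m≤m+n k 0) k≤m) bz ∷ []
  ball-along {k} (w ∷ is) bz (zw ∷ l) (w∉S ∷ is∉S) k+≤m =
    ball-mono (≤-trans (m≤m+n k _) k+≤m) bz ∷
    ball-along is (inj₂ (_ , bz , zw , w∉S)) l is∉S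
      (≤-trans (≤-reflexive (≡-sym (+-suc k (length is)))) k+≤m)

module _ {G : Graph n} {r : ℕ∞} {S : Subset n} {v : Fin n} where

  Sep-uniformRadius : ∀ us → All (Sep G r S v) us → ∃[ L ] L ≤∞ r × All (Sep G (fin L) S v) us
  Sep-uniformRadius []       []   = 0 , z≤∞ r , []
  Sep-uniformRadius (_ ∷ us) ((u∈S , is , ℓ , isPath , ℓ≤r , is∉S) ∷ seps)
    with Sep-uniformRadius us seps
  ... | L , L≤r , seps′ =
    ℓ ⊔ L , ⊔-lub-≤∞ r ℓ≤r L≤r ,
    (u∈S , is , ℓ , isPath , m≤m⊔n ℓ L , is∉S) ∷ All.map (map₂ (PathVia-mono G _ (m≤n⊔m ℓ L))) seps′

module _ (G : Graph n) (O : Order n) {S : Subset n} (dc : DownClosed O S) {v : Fin n} (v∉S : v ∉ S)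
         (L : ℕ) where
  open Walks (Adj G)

  Sep⇒SReach-fromBallMinimum :
    ∃[ x ] x ∉ S × (∀ {u} → Sep G (fin L) S v u → SReach G O (fin (pred L + L)) x u)
  Sep⇒SReach-fromBallMinimum = x , x∉S , sreach
    where
    minimum = argmin (ball? G S v (pred L)) (toℕ ∘ rank O) (ball-mono G S v z≤n refl)
    x = proj₁ minimum
    x∈ball = proj₁ (proj₂ minimum)
    x-least = proj₂ (proj₂ minimum)
    x∉S = ball-∉ G S v v∉S x∈ball

    x→v = ball-walk G S v x∈ball
    vs = steps (proj₁ x→v)

    sreach : ∀ {u} → Sep G (fin L) S v u → SReach G O (fin (pred L + L)) x u
    sreach (u∈S , _ , _ , inj₁ (refl , _) , _) = ⊥-elim (v∉S u∈S)
    sreach {u} (u∈S , is , _ , inj₂ (l , _ , refl) , ℓ≤L , is∉S) =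
      <⇒≤ (DownClosed⇒∈≺∉ O dc u∈S x∉S) ,
      PathVia-mono G _ length≤ (Walk⇒PathVia G (path q) (distinct q) x≢u
        (anti-mono (within q) visits) above-x)
      where
      q = shortcut _≟ᶠ_ (proj₁ x→v ▻ walk (is ∷ʳ u) l (ends-∷ʳ v is u))

      x≢u : x ≢ u
      x≢u = ≢-sym (∈∧∉⇒≢ u∈S x∉S)

      Visited : Fin n → Set
      Visited y = Ball G S v (pred L) y ⊎ y ≡ u

      is-inBall : All (Ball G S v (pred L)) is
      is-inBall = All.tail (ball-along G S v is refl l is∉S (suc[m]≤n⇒m≤pred[n] ℓ≤L))

      visits : All Visited (x ∷ vs ++ is ∷ʳ u)
      visits = ++⁺ (All.map inj₁ (proj₂ (proj₂ x→v))) (∷ʳ⁺ (All.map inj₁ is-inBall) (inj₂ refl))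

      above-x : ∀ {y} → Visited y → y ≢ x → y ≢ u → x ≺[ O ] y
      above-x (inj₁ y∈ball) y≢x _   = ≼∧≢⇒≺ O (x-least y∈ball) (≢-sym y≢x)
      above-x (inj₂ y≡u)    _   y≢u = ⊥-elim (y≢u y≡u)

      length≤ : length (steps (path q)) ≤ pred L + L
      length≤ = begin
        length (steps (path q))      ≤⟨ short q ⟩
        length (vs ++ is ∷ʳ u)       ≡⟨ length-++ vs ⟩
        length vs + length (is ∷ʳ u) ≡⟨ cong (length vs +_) (length-∷ʳ is u) ⟩
        length vs + suc (length is)  ≤⟨ +-mono-≤ (proj₁ (proj₂ x→v)) ℓ≤L ⟩
        pred L + L                   ∎
        where open ≤-Reasoning

SColBound⇒SWBound : ∀ (G : Graph n) r {s} → SColBound G (twoR-1 r) s → SWBound G r (pred s)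
SColBound⇒SWBound G r (O , sreach≤s) = O , λ S dc v v∉S us uniq seps →
  let L , L≤r , seps′ = Sep-uniformRadius {G = G} {r} {S} {v} us seps
      x , x∉S , sep⇒sreach = Sep⇒SReach-fromBallMinimum G O dc v∉S L
  in AtMost-delete (sreach≤s x) (SReach-refl G _ O x)
       (map₂ (PathVia-mono G _ (pred+≤∞twoR-1 r L≤r)) ∘ sep⇒sreach)
       (λ (u∈S , _) → ∈∧∉⇒≢ u∈S x∉S) us uniq seps′

-- The bounds hold for r = 0 as well.
lemma1p7 : ∀ {n} → 1 ≤ n → (G : Graph n) → (r : ℕ∞) → 1≤∞ r →
    ∀ (s w t s' : ℕ) →
    IsSCol G r s → IsWCol G r w → IsSW G r t → IsSCol G (twoR-1 r) s' →
    (s ≤ suc t × suc t ≤ w) × (s ≤ suc t × suc t ≤ s')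
lemma1p7 {suc _} _ G r _ s w t s′ (_ , s-least) (wcol , _) t-isSW@(sw , _) (scol′ , _) =
  (s≤1+t , 1+t≤w) , (s≤1+t , 1+t≤s′)
  where
  s≤1+t : s ≤ suc t
  s≤1+t = s-least (suc t) (SWBound⇒SColBound G r sw)

  1+t≤w : suc t ≤ w
  1+t≤w = IsLeast⇒suc≤ t-isSW (WColBound-positive G r fzero wcol) (WColBound⇒SWBound G r wcol)

  1+t≤s′ : suc t ≤ s′
  1+t≤s′ = IsLeast⇒suc≤ t-isSW (SColBound-positive G _ fzero scol′) (SColBound⇒SWBound G r scol′)
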